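{- Let $b \geqslant 2$ be an integer and let $G$ be a locally $b$-partite graph with $\delta(G) > \frac{2b}{2b+3}|G|$. Then for each vertex $v$ of $G$, the set \[D_v := \{u : \text{the pair } u,v \text{ is } b\text{ -dense}\}\] is an independent set of vertices.
   Context: Graphs are finite and simple; $|G|$ is the number of vertices, $\delta(G)$ the minimum degree. A graph is locally $b$-partite if the neighbourhood of every vertex induces a $b$-colourable graph. A pair of vertices $u,v$ is $b$-dense if the subgraph induced on their common neighbourhood contains a clique on $b$ vertices. -}

module Defs where

open import Data.Nat using (ℕ; _+_; _*_; _<_)
open import Data.Fin using (Fin)
open import Data.Bool using (Bool; true; false; if_then_else_)
open import Data.List using (map; allFin)
open import Data.Nat.ListAction using (sum)
open import Data.Product using (Σ; _×_)
open import Relation.Binary.PropositionalEquality using (_≡_; _≢_)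

record Graph (n : ℕ) : Set where
  field
    adj    : Fin n → Fin n → Bool
    sym    : ∀ x y → adj x y ≡ adj y x
    irrefl : ∀ x → adj x x ≡ false

open Graph public

Adj : {n : ℕ} → Graph n → Fin n → Fin n → Set
Adj G x y = adj G x y ≡ true

degree : {n : ℕ} → Graph n → Fin n → ℕ
degree {n} G v = sum (map (λ u → if adj G v u then 1 else 0) (allFin n))

-- δ(G) > (2b/(2b+3)) |G|, i.e. every vertex v has (2b+3)·deg v > 2b·|G|
MinDegreeAbove : {n : ℕ} → ℕ → Graph n → Set
MinDegreeAbove {n} b G = ∀ v → (2 * b) * n < (2 * b + 3) * degree G v

LocallyPartite : {n : ℕ} → ℕ → Graph n → Set
LocallyPartite {n} b G =
  ∀ v → Σ (Fin n → Fin b) λ c →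
    ∀ x y → Adj G v x → Adj G v y → Adj G x y → c x ≢ c y

Dense : {n : ℕ} → ℕ → Graph n → Fin n → Fin n → Set
Dense {n} b G u v =
  Σ (Fin b → Fin n) λ f →
    (∀ i → Adj G u (f i) × Adj G v (f i)) ×
    (∀ i j → i ≢ j → Adj G (f i) (f j))

IndependentSet : {n : ℕ} → Graph n → (Fin n → Set) → Set
IndependentSet {n} G S = ∀ x y → S x → S y → adj G x y ≡ false

-- Suppose x, y ∈ D_v are adjacent, with b-cliques K_x, K_y in the common
-- neighbourhoods of x, v and of y, v, and count for every vertex w its
-- neighbours in the 2b+3 vertices v, x, K_x, y, K_y. Since N(w) is
-- b-colourable it has no (b+1)-clique, so w sees at most b of the clique x + K_x
-- and at most b of y + K_y. If w ~ v, then w misses some vertex of K_x (as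
-- v + K_x is a clique), and if w still sees b of x + K_x then x and v are both
-- complete to a (b-1)-clique of N(w), which forces c(x) = c(v) for the colouring
-- c of N(w). As this cannot happen for both x and y (they are adjacent), w has at
-- most 2b neighbours among the 2b+3 vertices. Summing over w, their degrees add
-- up to at most 2b|G|, contradicting δ(G) > 2b|G|/(2b+3).
module Submission where

open import Data.Bool using (Bool; true; false; if_then_else_; _≟_)
open import Data.Bool.Properties using (¬-not)
open import Data.Empty using (⊥-elim)
open import Data.Fin as Fin using (Fin; zero; suc; punchIn; splitAt)
open import Data.Fin.Properties using (all?; ¬∀⟶∃¬; pigeonhole; <⇒≢; punchIn-injective)
open import Data.List using (map; allFin; tabulate)
open import Data.List.Properties using (map-tabulate)
import Data.Nat.ListAction as List
open import Data.Nat using (ℕ; zero; suc; _+_; _*_; _≤_; _<_; z≤n; s≤s; s<s)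
open import Data.Nat.Properties
  using (+-assoc; +-suc; +-identityʳ; *-identityʳ; *-comm; +-mono-≤; +-mono-<-≤; *-monoʳ-≤;
         ≤-refl; ≤-reflexive; ≤-trans; <⇒≤; <-irrefl; n<1+n; +-*-semiring; module ≤-Reasoning)
open import Data.Nat.Tactic.RingSolver using (solve-∀)
open import Data.Product as Product using (∃; _×_; _,_; proj₁; proj₂)
open import Data.Sum using (_⊎_; inj₁; inj₂)
open import Data.Sum.Properties using ([,]-map)
open import Data.Vec.Functional using (Vector; _∷_; _++_; removeAt)
open import Function using (_∘_; id)
open import Relation.Nullary using (¬_; yes; no)
open import Relation.Binary.PropositionalEquality

open import Defs hiding (sym; irrefl)

open import Algebra.Properties.Semiring.Sum +-*-semiring
  using (sum; sum-syntax; sum-cong-≗; sum-remove; ∑-comm; *-distribˡ-sum)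

sum-tabulate : ∀ {n} (f : Fin n → ℕ) → List.sum (tabulate f) ≡ sum f
sum-tabulate {zero}  f = refl
sum-tabulate {suc n} f = cong (f zero +_) (sum-tabulate (f ∘ suc))

sum-map-allFin : ∀ {n} (f : Fin n → ℕ) → List.sum (map f (allFin n)) ≡ sum f
sum-map-allFin f = trans (cong List.sum (map-tabulate id f)) (sum-tabulate f)

sum-∘-++ : ∀ {m k} {A : Set} (h : A → ℕ) (xs : Vector A m) (ys : Vector A k) →
           sum (h ∘ (xs ++ ys)) ≡ sum (h ∘ xs) + sum (h ∘ ys)
sum-∘-++ {zero}  h xs ys = refl
sum-∘-++ {suc m} h xs ys = begin
  h (xs zero) + sum (h ∘ (xs ++ ys) ∘ suc)
    ≡⟨ cong (h (xs zero) +_) (sum-cong-≗ (λ i → cong h ([,]-map (splitAt m i)))) ⟩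
  h (xs zero) + sum (h ∘ (xs ∘ suc ++ ys))
    ≡⟨ cong (h (xs zero) +_) (sum-∘-++ h (xs ∘ suc) ys) ⟩
  h (xs zero) + (sum (h ∘ xs ∘ suc) + sum (h ∘ ys))
    ≡⟨ +-assoc (h (xs zero)) _ _ ⟨
  sum (h ∘ xs) + sum (h ∘ ys) ∎
  where open ≡-Reasoning

sum≤*  : ∀ {k c} {f : Vector ℕ k} → (∀ i → f i ≤ c) → sum f ≤ k * c
sum≤* {zero}  f≤c = z≤n
sum≤* {suc k} f≤c = +-mono-≤ (f≤c zero) (sum≤* (f≤c ∘ suc))

*≤sum  : ∀ {k c} {f : Vector ℕ k} → (∀ i → c ≤ f i) → k * c ≤ sum f
*≤sum {zero}  c≤f = z≤n
*≤sum {suc k} c≤f = +-mono-≤ (c≤f zero) (*≤sum (c≤f ∘ suc))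

*<sum  : ∀ {k c} {f : Vector ℕ (suc k)} → (∀ i → c < f i) → suc k * c < sum f
*<sum c<f = +-mono-<-≤ (c<f zero) (*≤sum (<⇒≤ ∘ c<f ∘ suc))

𝟙 : Bool → ℕ
𝟙 b = if b then 1 else 0

count : ∀ {k} → Vector Bool k → ℕ
count {k} g = ∑[ i < k ] 𝟙 (g i)

𝟙≤1 : ∀ b → 𝟙 b ≤ 1
𝟙≤1 true  = ≤-refl
𝟙≤1 false = z≤n

count≤length : ∀ {k} (g : Vector Bool k) → count g ≤ k
count≤length {k} g = ≤-trans (sum≤* (𝟙≤1 ∘ g)) (≤-reflexive (*-identityʳ k))

count-∘-++ : ∀ {m k} {A : Set} (g : A → Bool) (xs : Vector A m) (ys : Vector A k) →
             count (g ∘ (xs ++ ys)) ≡ count (g ∘ xs) + count (g ∘ ys)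
count-∘-++ g = sum-∘-++ (𝟙 ∘ g)

count-removeAt-false : ∀ {k} (g : Vector Bool (suc k)) a → g a ≡ false →
                       count g ≡ count (removeAt g a)
count-removeAt-false g a ga≡false =
  trans (sum-remove {i = a} (𝟙 ∘ g)) (cong (λ t → 𝟙 t + count (removeAt g a)) ga≡false)

false⇒count≤ : ∀ {k} (g : Vector Bool (suc k)) a → g a ≡ false → count g ≤ k
false⇒count≤ g a ga≡false =
  ≤-trans (≤-reflexive (count-removeAt-false g a ga≡false)) (count≤length (removeAt g a))

¬all-true⇒false : ∀ {k} (g : Vector Bool k) → ¬ (∀ i → g i ≡ true) → ∃ λ a → g a ≡ false
¬all-true⇒false {k} g ¬all = Product.map₂ ¬-not (¬∀⟶∃¬ k _ (λ i → g i ≟ true) ¬all)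

false⇒count<⊎rest-true : ∀ {k} (g : Vector Bool (suc k)) a → g a ≡ false →
                         count g < k ⊎ (∀ i → removeAt g a i ≡ true)
false⇒count<⊎rest-true {zero}  g a ga≡false = inj₂ (λ ())
false⇒count<⊎rest-true {suc k} g a ga≡false with all? (λ i → removeAt g a i ≟ true)
... | yes rest-true = inj₂ rest-true
... | no ¬rest-true =
  let a′ , g′a′≡false = ¬all-true⇒false (removeAt g a) ¬rest-true in
  inj₁ (s≤s (≤-trans (≤-reflexive (count-removeAt-false g a ga≡false))
                     (false⇒count≤ (removeAt g a) a′ g′a′≡false)))

IsClique : ∀ {n k} → Graph n → Vector (Fin n) k → Set
IsClique G q = ∀ i j → i ≢ j → Adj G (q i) (q j)

module _ {n} (G : Graph n) where

  Adj-sym : ∀ {x y} → Adj G x y → Adj G y x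
  Adj-sym {x} {y} x~y = trans (Graph.sym G y x) x~y

  ∷-isClique : ∀ {k z} {q : Vector (Fin n) k} → IsClique G q → (∀ i → Adj G z (q i)) →
               IsClique G (z ∷ q)
  ∷-isClique q-clique z~q zero    zero    0≢0 = ⊥-elim (0≢0 refl)
  ∷-isClique q-clique z~q zero    (suc j) _   = z~q j
  ∷-isClique q-clique z~q (suc i) zero    _   = Adj-sym (z~q i)
  ∷-isClique q-clique z~q (suc i) (suc j) i≢j = q-clique i j (i≢j ∘ cong suc)

  removeAt-isClique : ∀ {k} {q : Vector (Fin n) (suc k)} → IsClique G q → ∀ a →
                      IsClique G (removeAt q a)
  removeAt-isClique q-clique a i j i≢j = q-clique _ _ (i≢j ∘ punchIn-injective a i j)

  module ColouredNeighbourhood {m} (w : Fin n) (c : Fin n → Fin (suc m))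
    (proper : ∀ x y → Adj G w x → Adj G w y → Adj G x y → c x ≢ c y) where

    no-clique-of-size-2+m : (q : Vector (Fin n) (suc (suc m))) → IsClique G q →
                            ¬ (∀ i → Adj G w (q i))
    no-clique-of-size-2+m q q-clique w~q with pigeonhole (n<1+n (suc m)) (c ∘ q)
    ... | i , j , i<j , same = proper _ _ (w~q i) (w~q j) (q-clique i j (<⇒≢ i<j)) same

    same-colour-over-clique : (r : Vector (Fin n) m) → IsClique G r → (∀ i → Adj G w (r i)) →
      ∀ {p q} → Adj G w p → Adj G w q → (∀ i → Adj G p (r i)) → (∀ i → Adj G q (r i)) →
      c p ≡ c q
    same-colour-over-clique r r-clique w~r {p} {q} w~p w~q p~r q~r with c p Fin.≟ c q
    ... | yes same = same
    ... | no differ with pigeonhole (n<1+n (suc m)) (c ∘ (p ∷ q ∷ r))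
    ... | zero        , suc zero    , _             , same = ⊥-elim (differ same)
    ... | zero        , suc (suc k) , _             , same =
      ⊥-elim (proper _ _ w~p (w~r k) (p~r k) same)
    ... | suc zero    , suc (suc k) , _             , same =
      ⊥-elim (proper _ _ w~q (w~r k) (q~r k) same)
    ... | suc zero    , suc zero    , s<s ()        , _
    ... | suc (suc k) , suc (suc l) , s<s (s<s k<l) , same =
      ⊥-elim (proper _ _ (w~r k) (w~r l) (r-clique k l (<⇒≢ k<l)) same)

    block-count≤ : ∀ {z} (f : Vector (Fin n) (suc m)) → IsClique G f → (∀ i → Adj G z (f i)) →
                   count (adj G w ∘ (z ∷ f)) ≤ suc m
    block-count≤ {z} f f-clique z~f =
      let a , w≁a = ¬all-true⇒false (adj G w ∘ (z ∷ f))
                      (no-clique-of-size-2+m (z ∷ f) (∷-isClique f-clique z~f))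
      in false⇒count≤ (adj G w ∘ (z ∷ f)) a w≁a

    misses-clique-completed-by-neighbour : ∀ {v} (f : Vector (Fin n) (suc m)) → IsClique G f →
      Adj G w v → (∀ i → Adj G v (f i)) → ∃ λ a → adj G w (f a) ≡ false
    misses-clique-completed-by-neighbour {v} f f-clique w~v v~f = ¬all-true⇒false _ λ w~f →
      no-clique-of-size-2+m (v ∷ f) (∷-isClique f-clique v~f) λ { zero → w~v ; (suc i) → w~f i }

    apex-block-count : ∀ {v z} (f : Vector (Fin n) (suc m)) → IsClique G f →
      Adj G w v → (∀ i → Adj G v (f i)) → (∀ i → Adj G z (f i)) →
      count (adj G w ∘ (z ∷ f)) < suc m ⊎ (Adj G w z × c z ≡ c v)
    apex-block-count {v} {z} f f-clique w~v v~f z~f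
      with misses-clique-completed-by-neighbour f f-clique w~v v~f | adj G w z in w~z
    ... | a , w≁fa | false = inj₁ (s≤s (false⇒count≤ (adj G w ∘ f) a w≁fa))
    ... | a , w≁fa | true with false⇒count<⊎rest-true (adj G w ∘ f) a w≁fa
    ...   | inj₁ few = inj₁ (s≤s few)
    ...   | inj₂ w~rest = inj₂ (refl , same-colour-over-clique (removeAt f a)
              (removeAt-isClique f-clique a) w~rest w~z w~v (z~f ∘ punchIn a) (v~f ∘ punchIn a))

  degree≡∑ : ∀ t → degree G t ≡ ∑[ w < n ] 𝟙 (adj G w t)
  degree≡∑ t = trans (sum-map-allFin (λ u → 𝟙 (adj G t u)))
                     (sum-cong-≗ (λ w → cong 𝟙 (Graph.sym G t w)))

  ∑degree≡∑count : ∀ {k} (us : Vector (Fin n) k) →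
                   ∑[ i < k ] degree G (us i) ≡ ∑[ w < n ] count (adj G w ∘ us)
  ∑degree≡∑count us = trans (sum-cong-≗ (degree≡∑ ∘ us)) (∑-comm (λ i w → 𝟙 (adj G w (us i))))

  high-degree⇒crowded-vertex : ∀ {k d} (us : Vector (Fin n) (suc k)) →
    (∀ i → d * n < suc k * degree G (us i)) → ¬ (∀ w → count (adj G w ∘ us) ≤ d)
  high-degree⇒crowded-vertex {k} {d} us high sparse = <-irrefl refl (begin-strict
    suc k * (d * n)                            <⟨ *<sum high ⟩
    (∑[ i < suc k ] (suc k * degree G (us i))) ≡⟨ *-distribˡ-sum (suc k) (degree G ∘ us) ⟨
    suc k * (∑[ i < suc k ] degree G (us i))   ≡⟨ cong (suc k *_) (∑degree≡∑count us) ⟩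
    suc k * (∑[ w < n ] count (adj G w ∘ us))  ≤⟨ *-monoʳ-≤ (suc k) (sum≤* sparse) ⟩
    suc k * (n * d)                            ≡⟨ cong (suc k *_) (*-comm n d) ⟩
    suc k * (d * n)                            ∎)
    where open ≤-Reasoning

dense-pair-family : ∀ {n b} (G : Graph n) (v x y : Fin n) →
  Dense b G x v → Dense b G y v → Vector (Fin n) (suc (suc b + suc b))
dense-pair-family G v x y (fx , _) (fy , _) = v ∷ (x ∷ fx) ++ (y ∷ fy)

module _ {n m} (G : Graph n) (locally-partite : LocallyPartite (suc m) G) where

  dense-pair-count≤ : ∀ {v x y} → Adj G x y →
    (Dx : Dense (suc m) G x v) (Dy : Dense (suc m) G y v) →
    ∀ w → count (adj G w ∘ dense-pair-family G v x y Dx Dy) ≤ 2 * suc m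
  dense-pair-count≤ {v} {x} {y} x~y (fx , fx-common , fx-clique) (fy , fy-common , fy-clique) w =
    begin
      𝟙 (adj G w v) + count (adj G w ∘ ((x ∷ fx) ++ (y ∷ fy)))
        ≡⟨ cong (𝟙 (adj G w v) +_) (count-∘-++ (adj G w) (x ∷ fx) (y ∷ fy)) ⟩
      𝟙 (adj G w v) + (count (adj G w ∘ (x ∷ fx)) + count (adj G w ∘ (y ∷ fy)))
        ≤⟨ by-adjacency-to-v ⟩
      suc m + suc m
        ≡⟨ cong (suc m +_) (+-identityʳ (suc m)) ⟨
      2 * suc m ∎
    where
    open ≤-Reasoning
    open ColouredNeighbourhood G w (proj₁ (locally-partite w)) (proj₂ (locally-partite w))

    x-block≤ : count (adj G w ∘ (x ∷ fx)) ≤ suc m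
    x-block≤ = block-count≤ fx fx-clique (proj₁ ∘ fx-common)
    y-block≤ : count (adj G w ∘ (y ∷ fy)) ≤ suc m
    y-block≤ = block-count≤ fy fy-clique (proj₁ ∘ fy-common)

    by-adjacency-to-v : 𝟙 (adj G w v) + (count (adj G w ∘ (x ∷ fx)) + count (adj G w ∘ (y ∷ fy)))
                        ≤ suc m + suc m
    by-adjacency-to-v with adj G w v in w~v
    ... | false = +-mono-≤ x-block≤ y-block≤
    ... | true
      with apex-block-count fx fx-clique w~v (proj₂ ∘ fx-common) (proj₁ ∘ fx-common)
         | apex-block-count fy fy-clique w~v (proj₂ ∘ fy-common) (proj₁ ∘ fy-common)
    ... | inj₁ x-few | _ = +-mono-≤ x-few y-block≤
    ... | inj₂ _ | inj₁ y-few =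
      ≤-trans (≤-reflexive (sym (+-suc (count (adj G w ∘ (x ∷ fx))) _))) (+-mono-≤ x-block≤ y-few)
    ... | inj₂ (w~x , cx≡cv) | inj₂ (w~y , cy≡cv) =
      ⊥-elim (proj₂ (locally-partite w) x y w~x w~y x~y (trans cx≡cv (sym cy≡cv)))

lemma4p5 : (b : ℕ) → 2 ≤ b → {n : ℕ} → (G : Graph n) →
    LocallyPartite b G → MinDegreeAbove b G →
    (v : Fin n) → IndependentSet G (λ u → Dense b G u v)
lemma4p5 zero    ()
lemma4p5 (suc m) _ {n} G locally-partite min-degree v x y Dx Dy with adj G x y in x~y
... | false = refl
... | true = ⊥-elim (high-degree⇒crowded-vertex G (dense-pair-family G v x y Dx Dy)
                       (high-degree ∘ dense-pair-family G v x y Dx Dy)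
                       (dense-pair-count≤ G locally-partite x~y Dx Dy))
  where
  family-length : ∀ b → 2 * b + 3 ≡ suc (suc b + suc b)
  family-length = solve-∀

  high-degree : ∀ t → 2 * suc m * n < suc (suc (suc m) + suc (suc m)) * degree G t
  high-degree t =
    subst (λ k → 2 * suc m * n < k * degree G t) (family-length (suc m)) (min-degree t)
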